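{- Let $\mathcal{S}=(\mathcal{S}_1,\dots,\mathcal{S}_\ell)$ be a move sequence, $\tau_0\in\{\pm1\}^{V(\mathcal{S})}$, and let $(i,j)$ be an arc of $\mathcal{S}$ with $\mathcal{S}_i=\mathcal{S}_j=\{u\}$. Let $\gamma_0\in\{\pm1\}^n$ be any extension of $\tau_0$ with induced configurations $\gamma_0,\dots,\gamma_\ell$, and let $w[u,i,j]=\gamma_i(u)\,\mathrm{imprv}_{\gamma_0,\mathcal{S}}(i)-\gamma_j(u)\,\mathrm{imprv}_{\gamma_0,\mathcal{S}}(j)\in\mathbb{Z}^{E_n}$. Then for every $e\in E(\mathcal{S})$, $w[u,i,j]_e=\big(\tau_i(u)\,\mathrm{imprv}_{\tau_0,\mathcal{S}}(i)-\tau_j(u)\,\mathrm{imprv}_{\tau_0,\mathcal{S}}(j)\big)_e$, and $w[u,i,j]_e=0$ for every $e\in E_n\setminus E(\mathcal{S})$.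
   Context: $V_n=[n]$, $K_n=(V_n,E_n)$ complete graph. A move sequence is $\mathcal{S}=(\mathcal{S}_1,\dots,\mathcal{S}_\ell)$ with each $\mathcal{S}_i\subseteq V_n$ of size 1 or 2; $V(\mathcal{S})$ is the set of nodes occurring in it, $E(\mathcal{S})$ the set of edges with both endpoints in $V(\mathcal{S})$. Given $\gamma_0\in\{\pm1\}^n$ (resp. $\tau_0\in\{\pm1\}^{V(\mathcal{S})}$), $\gamma_i$ (resp. $\tau_i$) is obtained from $\gamma_{i-1}$ (resp. $\tau_{i-1}$) by flipping the nodes of $\mathcal{S}_i$. $\mathrm{imprv}_{\gamma_0,\mathcal{S}}(i)\in\{0,\pm1\}^{E_n}$: if $\mathcal{S}_i=\{u\}$, its entry at $\{u,w\}$ ($w\neq u$) is $\gamma_{i-1}(u)\gamma_{i-1}(w)$, other entries 0; if $\mathcal{S}_i=\{u,v\}$, entry at $\{u,w\}$ ($w\notin\{u,v\}$) is $\gamma_{i-1}(u)\gamma_{i-1}(w)$, at $\{v,w\}$ ($w\notin\{u,v\}$) is $\gamma_{i-1}(v)\gamma_{i-1}(w)$, others 0. $\mathrm{imprv}_{\tau_0,\mathcal{S}}(i)$ is the restriction of $\mathrm{imprv}_{\gamma_0,\mathcal{S}}(i)$ to coordinates in $E(\mathcal{S})$ for any extension $\gamma_0$ of $\tau_0$. An arc is a pair $(i,j)$, $i<j$, with $\mathcal{S}_i=\mathcal{S}_j=\{u\}$ for some node $u$ and $\mathcal{S}_k\neq\{u\}$ for all $i<k<j$. -}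

module Defs where

open import Data.Nat using (ℕ; zero; suc)
open import Data.Fin using (Fin; toℕ) renaming (_<_ to _<ᶠ_)
open import Data.Fin.Properties using (_≟_)
open import Data.Bool using (Bool; true; false; _∨_; _xor_; T; if_then_else_)
open import Data.Vec using (Vec; []; _∷_; lookup)
open import Data.Integer using (ℤ; 0ℤ; 1ℤ; -1ℤ; _-_) renaming (_*_ to _*ℤ_)
open import Data.Sign using (Sign) renaming (_*_ to _*ˢ_)
open import Data.Product using (_×_; _,_)
open import Relation.Nullary using (¬_)
open import Relation.Nullary.Decidable using (⌊_⌋)
open import Relation.Binary.PropositionalEquality using (_≡_; _≢_)

data Move (n : ℕ) : Set where
  single : Fin n → Move n
  pair   : (u v : Fin n) → u ≢ v → Move n

_∈ᵐ_ : ∀ {n} → Fin n → Move n → Bool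
x ∈ᵐ single u   = ⌊ x ≟ u ⌋
x ∈ᵐ pair u v _ = ⌊ x ≟ u ⌋ ∨ ⌊ x ≟ v ⌋

-- A move sequence S = (S_1,…,S_ℓ) is a vector of length ℓ; position
-- i : Fin ℓ stands for the paper's index (toℕ i + 1).
MoveSeq : ℕ → ℕ → Set
MoveSeq n ℓ = Vec (Move n) ℓ

-- V(S): nodes occurring in S (decidable, proof-irrelevant membership)
occurs : ∀ {n ℓ} → Fin n → MoveSeq n ℓ → Bool
occurs x []      = false
occurs x (m ∷ S) = (x ∈ᵐ m) ∨ occurs x S

_∈V_ : ∀ {n ℓ} → Fin n → MoveSeq n ℓ → Set
x ∈V S = T (occurs x S)

-- Edges of K_n: unordered pairs {a,b}, a ≠ b, stored with a < b.
record Edge (n : ℕ) : Set where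
  constructor edge
  field
    a   : Fin n
    b   : Fin n
    a<b : a <ᶠ b
open Edge public

_∈E_ : ∀ {n ℓ} → Edge n → MoveSeq n ℓ → Set
e ∈E S = (a e ∈V S) × (b e ∈V S)

⟦_⟧ : Sign → ℤ
⟦ Sign.+ ⟧ = 1ℤ
⟦ Sign.- ⟧ = -1ℤ

flipS : ∀ {n} → Move n → Fin n → Sign → Sign
flipS m x s = if x ∈ᵐ m then Data.Sign.opposite s else s

Conf : ℕ → Set
Conf n = Fin n → Sign

TConf : ∀ {n ℓ} → MoveSeq n ℓ → Set
TConf {n} S = (x : Fin n) → x ∈V S → Sign

after : ∀ {n ℓ} {A : Set} → (Move n → A → A) → MoveSeq n ℓ → A → ℕ → A
after f []      c k       = c
after f (m ∷ S) c zero    = c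
after f (m ∷ S) c (suc k) = after f S (f m c) k

γ : ∀ {n ℓ} → MoveSeq n ℓ → Conf n → ℕ → Conf n
γ S = after (λ m g x → flipS m x (g x)) S

τ : ∀ {n ℓ} (S : MoveSeq n ℓ) → TConf S → ℕ → TConf S
τ S = after (λ m t x p → flipS m x (t x p)) S

Extends : ∀ {n ℓ} (S : MoveSeq n ℓ) → Conf n → TConf S → Set
Extends {n} S g t = (x : Fin n) (p : x ∈V S) → g x ≡ t x p

-- Entry of imprv at edge {x,y} for move m, given the spins sx, sy of x, y
-- in the configuration before the move.
--   m = {u}   : entry at {u,w} is s(u)s(w); others 0.
--   m = {u,v} : entry at {u,w}, {v,w} (w ∉ {u,v}) is s(u)s(w) resp. s(v)s(w);
--               others 0 — i.e. nonzero iff exactly one endpoint lies in m.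
imprvEntry : ∀ {n} → Move n → (x y : Fin n) → Sign → Sign → ℤ
imprvEntry (single u) x y sx sy =
  if ⌊ x ≟ u ⌋ ∨ ⌊ y ≟ u ⌋ then ⟦ sx *ˢ sy ⟧ else 0ℤ
imprvEntry m@(pair u v _) x y sx sy =
  if (x ∈ᵐ m) xor (y ∈ᵐ m) then ⟦ sx *ˢ sy ⟧ else 0ℤ

-- imprv_{γ0,S}(i) ∈ ℤ^{E_n}   (paper index toℕ i + 1, uses γ_{toℕ i})
imprvγ : ∀ {n ℓ} (S : MoveSeq n ℓ) → Conf n → Fin ℓ → Edge n → ℤ
imprvγ S g0 i e =
  imprvEntry (lookup S i) (a e) (b e) (γ S g0 (toℕ i) (a e)) (γ S g0 (toℕ i) (b e))

imprvτ : ∀ {n ℓ} (S : MoveSeq n ℓ) → TConf S → Fin ℓ → (e : Edge n) → e ∈E S → ℤ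
imprvτ S t0 i e (pa , pb) =
  imprvEntry (lookup S i) (a e) (b e) (τ S t0 (toℕ i) (a e) pa) (τ S t0 (toℕ i) (b e) pb)

IsArc : ∀ {n ℓ} → MoveSeq n ℓ → Fin ℓ → Fin ℓ → Fin n → Set
IsArc {ℓ = ℓ} S i j u =
  (i <ᶠ j) × (lookup S i ≡ single u) × (lookup S j ≡ single u) ×
  ((k : Fin ℓ) → i <ᶠ k → k <ᶠ j → lookup S k ≢ single u)

wγ : ∀ {n ℓ} (S : MoveSeq n ℓ) → Conf n → Fin n → Fin ℓ → Fin ℓ → Edge n → ℤ
wγ S g0 u i j e =
  (⟦ γ S g0 (suc (toℕ i)) u ⟧ *ℤ imprvγ S g0 i e)
    - (⟦ γ S g0 (suc (toℕ j)) u ⟧ *ℤ imprvγ S g0 j e)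

wτ : ∀ {n ℓ} (S : MoveSeq n ℓ) → TConf S → (u : Fin n) → u ∈V S →
     Fin ℓ → Fin ℓ → (e : Edge n) → e ∈E S → ℤ
wτ S t0 u hu i j e he =
  (⟦ τ S t0 (suc (toℕ i)) u hu ⟧ *ℤ imprvτ S t0 i e he)
    - (⟦ τ S t0 (suc (toℕ j)) u hu ⟧ *ℤ imprvτ S t0 j e he)

-- Moves act pointwise, so a configuration γ extending τ keeps extending it after every
-- prefix of S; hence w agrees with its restriction on E(S).  For an edge e ∉ E(S) the
-- term γ_i(u) imprv(i)_e of a move {u} is −γ_{i-1}(u)·γ_{i-1}(u)γ_{i-1}(w) = −γ_0(w) if
-- e = {u,w}, and 0 otherwise: w ∉ V(S) never flips, so the term is the same at i and j.
module Submission where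

open import Defs
open import Data.Nat using (ℕ; zero; suc)
open import Data.Fin using (Fin; toℕ; zero; suc)
open import Data.Fin.Properties using (_≟_)
open import Data.Integer using (0ℤ; -_; _-_) renaming (_*_ to _*ℤ_)
open import Data.Integer.Properties using (*-zeroʳ; i≡j⇒i-j≡0)
open import Data.Sign using (Sign; opposite) renaming (_*_ to _*ˢ_)
import Data.Sign.Properties as Signₚ
open import Data.Bool using (true; false; if_then_else_)
open import Data.Vec using ([]; _∷_; lookup)
open import Data.Product using (_×_; _,_)
open import Data.Empty using (⊥-elim)
open import Relation.Nullary using (¬_; yes; no)
open import Relation.Nullary.Decidable using (⌊_⌋)
open import Relation.Binary.PropositionalEquality using (_≡_; refl; sym; trans; cong; cong₂; cong-app)

private
  variable
    n ℓ ℓ′ : ℕ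

flipConf : Move n → Conf n → Conf n
flipConf m g x = flipS m x (g x)

flipTConf : {S : MoveSeq n ℓ} → Move n → TConf S → TConf S
flipTConf m t x p = flipS m x (t x p)

after-zero : ∀ {A : Set} (f : Move n → A → A) (L : MoveSeq n ℓ) (c : A) → after f L c 0 ≡ c
after-zero f []      c = refl
after-zero f (m ∷ L) c = refl

after-suc-toℕ : ∀ {A : Set} (f : Move n → A → A) (L : MoveSeq n ℓ) (c : A) (i : Fin ℓ) →
  after f L c (suc (toℕ i)) ≡ f (lookup L i) (after f L c (toℕ i))
after-suc-toℕ f (m ∷ L) c zero    = after-zero f L (f m c)
after-suc-toℕ f (m ∷ L) c (suc i) = after-suc-toℕ f L (f m c) i

flipS-single-self : (u : Fin n) (s : Sign) → flipS (single u) u s ≡ opposite s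
flipS-single-self u s with u ≟ u
... | yes _  = refl
... | no u≢u = ⊥-elim (u≢u refl)

γ-flips-moved : (S : MoveSeq n ℓ) (g : Conf n) {u : Fin n} (i : Fin ℓ) →
  lookup S i ≡ single u → γ S g (suc (toℕ i)) u ≡ opposite (γ S g (toℕ i) u)
γ-flips-moved S g {u} i Sᵢ≡u
  rewrite cong-app (after-suc-toℕ flipConf S g i) u | Sᵢ≡u
  = flipS-single-self u (γ S g (toℕ i) u)

γ-constant-outside : (S : MoveSeq n ℓ) (g : Conf n) (k : ℕ) {x : Fin n} →
  ¬ x ∈V S → γ S g k x ≡ g x
γ-constant-outside []      g k       x∉S = refl
γ-constant-outside (m ∷ S) g zero    x∉S = refl
γ-constant-outside (m ∷ S) g (suc k) {x} x∉S with x ∈ᵐ m in x∈m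
... | true  = ⊥-elim (x∉S _)
... | false with γ-constant-outside S (flipConf m g) k x∉S
...   | γₖx≡flipped rewrite x∈m = γₖx≡flipped

after-preserves-Extends : (S : MoveSeq n ℓ) (L : MoveSeq n ℓ′) {g : Conf n} {t : TConf S} →
  Extends S g t → (k : ℕ) → Extends S (γ L g k) (after (flipTConf {S = S}) L t k)
after-preserves-Extends S []      g⊒t k       = g⊒t
after-preserves-Extends S (m ∷ L) g⊒t zero    = g⊒t
after-preserves-Extends S (m ∷ L) g⊒t (suc k) =
  after-preserves-Extends S L (λ x p → cong (flipS m x) (g⊒t x p)) k

opposite-times-product : (s t : Sign) → ⟦ opposite s ⟧ *ℤ ⟦ s *ˢ t ⟧ ≡ - ⟦ t ⟧
opposite-times-product Sign.+ Sign.+ = refl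
opposite-times-product Sign.+ Sign.- = refl
opposite-times-product Sign.- Sign.+ = refl
opposite-times-product Sign.- Sign.- = refl

moved-term-off-E : (S : MoveSeq n ℓ) (g : Conf n) {u : Fin n} (i : Fin ℓ) →
  lookup S i ≡ single u → u ∈V S → (x y : Fin n) → ¬ (x ∈V S × y ∈V S) →
  ⟦ γ S g (suc (toℕ i)) u ⟧ *ℤ
    imprvEntry (lookup S i) x y (γ S g (toℕ i) x) (γ S g (toℕ i) y)
  ≡ (if ⌊ x ≟ u ⌋ then - ⟦ g y ⟧ else if ⌊ y ≟ u ⌋ then - ⟦ g x ⟧ else 0ℤ)
moved-term-off-E S g {u} i Sᵢ≡u u∈S x y e∉S
  rewrite γ-flips-moved S g i Sᵢ≡u | Sᵢ≡u
  with x ≟ u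
... | yes refl
  rewrite γ-constant-outside S g (toℕ i) (λ y∈S → e∉S (u∈S , y∈S))
  = opposite-times-product (γ S g (toℕ i) x) (g y)
... | no _ with y ≟ u
...   | yes refl
  rewrite γ-constant-outside S g (toℕ i) (λ x∈S → e∉S (x∈S , u∈S))
        | Signₚ.*-comm (g x) (γ S g (toℕ i) y)
  = opposite-times-product (γ S g (toℕ i) y) (g x)
...   | no _ = *-zeroʳ ⟦ opposite (γ S g (toℕ i) u) ⟧

lemma2p2 : ∀ {n ℓ} (S : MoveSeq n ℓ) (τ0 : TConf S) (i j : Fin ℓ) (u : Fin n) →
    IsArc S i j u → (hu : u ∈V S) → (γ0 : Conf n) → Extends S γ0 τ0 →
    ((e : Edge n) (he : e ∈E S) → wγ S γ0 u i j e ≡ wτ S τ0 u hu i j e he) ×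
    ((e : Edge n) → ¬ (e ∈E S) → wγ S γ0 u i j e ≡ 0ℤ)
lemma2p2 S τ0 i j u (_ , Sᵢ≡u , Sⱼ≡u , _) hu γ0 γ0⊒τ0 = on-E , off-E
  where
  γₖ⊒τₖ : (k : ℕ) → Extends S (γ S γ0 k) (τ S τ0 k)
  γₖ⊒τₖ = after-preserves-Extends S S γ0⊒τ0

  imprv-agrees : (k : Fin _) (e : Edge _) (he : e ∈E S) → imprvγ S γ0 k e ≡ imprvτ S τ0 k e he
  imprv-agrees k e (pa , pb) =
    cong₂ (imprvEntry (lookup S k) (a e) (b e)) (γₖ⊒τₖ (toℕ k) (a e) pa) (γₖ⊒τₖ (toℕ k) (b e) pb)

  signed-imprv-agrees : (k : Fin _) (e : Edge _) (he : e ∈E S) →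
    ⟦ γ S γ0 (suc (toℕ k)) u ⟧ *ℤ imprvγ S γ0 k e ≡ ⟦ τ S τ0 (suc (toℕ k)) u hu ⟧ *ℤ imprvτ S τ0 k e he
  signed-imprv-agrees k e he =
    cong₂ _*ℤ_ (cong ⟦_⟧ (γₖ⊒τₖ (suc (toℕ k)) u hu)) (imprv-agrees k e he)

  on-E : (e : Edge _) (he : e ∈E S) → wγ S γ0 u i j e ≡ wτ S τ0 u hu i j e he
  on-E e he = cong₂ _-_ (signed-imprv-agrees i e he) (signed-imprv-agrees j e he)

  off-E : (e : Edge _) → ¬ (e ∈E S) → wγ S γ0 u i j e ≡ 0ℤ
  off-E e e∉S = i≡j⇒i-j≡0
    (trans (moved-term-off-E S γ0 i Sᵢ≡u hu (a e) (b e) e∉S)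
           (sym (moved-term-off-E S γ0 j Sⱼ≡u hu (a e) (b e) e∉S)))
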